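{- Let $n\ge 12$ with $4\mid n$. Then there do not exist three Hamiltonian cycles $C_1,C_2,C_3$ on a common $n$-element vertex set such that $C_i\cup C_j$ is $K_4$-covered for all $1\le i<j\le 3$.
   Context: All graphs are finite and simple. A Hamiltonian cycle on a vertex set $V$ is a simple cycle through all vertices of $V$. For graphs $G,H$ on the same vertex set $V$, $G\cup H$ is the graph on $V$ with edge set $E(G)\cup E(H)$. A graph on $n$ vertices is $K_4$-covered if it contains $n/4$ vertex-disjoint copies of $K_4$, i.e. its vertex set can be partitioned into vertex sets of copies of $K_4$. -}

module Defs where

open import Data.Nat using (ℕ; suc; _*_; _%_)
open import Data.Nat.DivMod using (m%n<n)
open import Data.Fin using (Fin; toℕ; fromℕ<)
open import Data.Product using (Σ; ∃; _×_; _,_)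
open import Data.Sum using (_⊎_)
open import Relation.Binary.PropositionalEquality using (_≡_)
open import Relation.Nullary using (¬_)
open import Function.Bundles using (_↔_; Inverse)

Graph : ℕ → Set₁
Graph n = Fin n → Fin n → Set

_∪ᴳ_ : ∀ {n} → Graph n → Graph n → Graph n
(G ∪ᴳ H) u v = G u v ⊎ H u v

next : ∀ {m} → Fin (suc m) → Fin (suc m)
next {m} i = fromℕ< (m%n<n (suc (toℕ i)) (suc m))

-- A Hamiltonian cycle on Fin (suc m) is given by a cyclic ordering of all
-- vertices: a bijection from positions to vertices, ord i = i-th vertex.
HamCycle : ℕ → Set
HamCycle m = Fin (suc m) ↔ Fin (suc m)

cycleGraph : ∀ {m} → HamCycle m → Graph (suc m)
cycleGraph {m} C u v =
  ∃ λ (i : Fin (suc m)) →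
    (Inverse.to C i ≡ u × Inverse.to C (next i) ≡ v)
    ⊎ (Inverse.to C i ≡ v × Inverse.to C (next i) ≡ u)

-- G on Fin (4 * k) is K4-covered: its vertex set is partitioned into k
-- blocks of 4 vertices (a bijection Fin k × Fin 4 ↔ vertices), each block
-- spanning a copy of K4 (any two distinct vertices of a block are adjacent).
K4Covered : ∀ {N} → (k : ℕ) → 4 * k ≡ N → Graph N → Set
K4Covered {N} k _ G =
  Σ ((Fin k × Fin 4) ↔ Fin N) λ π →
    ∀ (b : Fin k) (i j : Fin 4) → ¬ i ≡ j →
      G (Inverse.to π (b , i)) (Inverse.to π (b , j))

module Submission where

-- A Hamiltonian cycle is treated as a cyclic order: an injective successor
-- map without orbits shorter than 12.  In the union of two such cycles X and
-- Y a K4 is the union of a Hamiltonian path of X and one of Y, so every block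
-- of a K4-partition of X ∪ Y is a segment of four consecutive X-vertices
-- whose other three pairs are Y-edges, and the blocks follow each other
-- along X.  Hence each vertex is interior to the X-path or to the Y-path of
-- its block, and no vertex is interior to its C-path in both partitions
-- involving C.  Comparing along C₁ the blocks of the partitions of C₁ ∪ C₂
-- and C₁ ∪ C₃, three of the four possible offsets contradict this at once;
-- the fourth is refuted by the neighbourhoods of a few vertices in the
-- partition of C₂ ∪ C₃.

open import Defs
open import Data.Nat using (ℕ; zero; suc; _+_; _*_; _%_; _/_; _≤_; _<_; z≤n; s≤s)
open import Data.Nat.Properties using (+-identityʳ; +-suc; +-comm; +-cancelˡ-≡; <-irrefl; <⇒≱; m≤m+n; <-≤-trans)
open import Data.Nat.DivMod using (m%n<n; m%n%n≡m%n; %-distribˡ-+; [m+n]%n≡m%n; m<n⇒m%n≡m; m≡m%n+[m/n]*n)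
open import Data.Nat.GeneralisedArithmetic using (fold; fold-+)
open import Data.Fin using (Fin; toℕ; #_; zero; suc)
open import Data.Fin.Properties using (toℕ-fromℕ<; toℕ-injective; toℕ<n)
open import Data.List using (List; []; _∷_)
open import Data.List.Relation.Unary.Any using (here; there)
open import Data.List.Membership.Propositional using (_∈_; _∉_)
open import Data.List.Relation.Binary.Permutation.Propositional using (_↭_; ↭-refl; prep; swap; ↭-sym; ↭-trans)
open import Data.List.Relation.Binary.Permutation.Propositional.Properties using (shift; ↭-reverse; ∈-resp-↭)
open import Data.Product using (Σ; _×_; _,_; proj₁; proj₂)
open import Data.Sum using (_⊎_; inj₁; inj₂; [_,_]′)
open import Data.Empty using (⊥; ⊥-elim)
open import Function.Bundles using (Inverse)
open import Relation.Binary.PropositionalEquality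
open import Relation.Nullary using (¬_)

module CyclicSuccessor (m : ℕ) where
  private
    N : ℕ
    N = suc m

  toℕ-fold-next : ∀ k (i : Fin N) → toℕ (fold i next k) ≡ (toℕ i + k) % N
  toℕ-fold-next zero i = begin
      toℕ i             ≡⟨ sym (m<n⇒m%n≡m (toℕ<n i)) ⟩
      toℕ i % N         ≡⟨ cong (_% N) (sym (+-identityʳ (toℕ i))) ⟩
      (toℕ i + 0) % N   ∎
    where open ≡-Reasoning
  toℕ-fold-next (suc k) i = begin
      toℕ (next (fold i next k))              ≡⟨ toℕ-fromℕ< (m%n<n (suc (toℕ (fold i next k))) N) ⟩
      (1 + toℕ (fold i next k)) % N           ≡⟨ cong (λ t → (1 + t) % N) (toℕ-fold-next k i) ⟩
      (1 + (toℕ i + k) % N) % N               ≡⟨ %-distribˡ-+ 1 ((toℕ i + k) % N) N ⟩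
      (1 % N + (toℕ i + k) % N % N) % N       ≡⟨ cong (λ t → (1 % N + t) % N) (m%n%n≡m%n (toℕ i + k) N) ⟩
      (1 % N + (toℕ i + k) % N) % N           ≡⟨ sym (%-distribˡ-+ 1 (toℕ i + k) N) ⟩
      (1 + (toℕ i + k)) % N                   ≡⟨ cong (_% N) (sym (+-suc (toℕ i) k)) ⟩
      (toℕ i + suc k) % N                     ∎
    where open ≡-Reasoning

  fold-next-N : (i : Fin N) → fold i next N ≡ i
  fold-next-N i = toℕ-injective (begin
      toℕ (fold i next N)   ≡⟨ toℕ-fold-next N i ⟩
      (toℕ i + N) % N       ≡⟨ [m+n]%n≡m%n (toℕ i) N ⟩
      toℕ i % N             ≡⟨ m<n⇒m%n≡m (toℕ<n i) ⟩
      toℕ i                 ∎)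
    where open ≡-Reasoning

  -- next is injective: the remaining m successors invert it.
  next-injective : ∀ {i j : Fin N} → next i ≡ next j → i ≡ j
  next-injective {i} {j} eq = begin
      i                       ≡⟨ sym (fold-next-N i) ⟩
      fold i next N           ≡⟨ cong (fold i next) (+-comm 1 m) ⟩
      fold i next (m + 1)     ≡⟨ fold-+ i next m ⟩
      fold (next i) next m    ≡⟨ cong (λ t → fold t next m) eq ⟩
      fold (next j) next m    ≡⟨ sym (fold-+ j next m) ⟩
      fold j next (m + 1)     ≡⟨ cong (fold j next) (+-comm m 1) ⟩
      fold j next N           ≡⟨ fold-next-N j ⟩
      j                       ∎
    where open ≡-Reasoning

  notMultiple : ∀ {k} q → 0 < k → k < N → k ≢ q * N
  notMultiple zero    0<k _   refl = <-irrefl refl 0<k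
  notMultiple (suc q) _   k<N refl = <⇒≱ k<N (m≤m+n N (q * N))

  noShortOrbit : ∀ k (i : Fin N) → 0 < k → k < N → fold i next k ≢ i
  noShortOrbit k i 0<k k<N loop =
    notMultiple ((toℕ i + k) / N) 0<k k<N (+-cancelˡ-≡ (toℕ i) k _ (begin
      toℕ i + k                                      ≡⟨ m≡m%n+[m/n]*n (toℕ i + k) N ⟩
      (toℕ i + k) % N + (toℕ i + k) / N * N          ≡⟨ cong (_+ (toℕ i + k) / N * N) remainder ⟩
      toℕ i + (toℕ i + k) / N * N                    ∎))
    where
      open ≡-Reasoning
      remainder : (toℕ i + k) % N ≡ toℕ i
      remainder = trans (sym (toℕ-fold-next k i)) (cong toℕ loop)

-- A cyclic order on V of length at least 12, given by its successor map:
-- the successor is injective and no vertex returns to itself in 1..11 steps.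
record Cycle (V : Set) : Set where
  field
    succ           : V → V
    succ-injective : ∀ {u v} → succ u ≡ succ v → u ≡ v
    noShortReturn  : ∀ (d : Fin 11) v → fold v succ (suc (toℕ d)) ≢ v

Adj : ∀ {V} → Cycle V → V → V → Set
Adj C u v = Cycle.succ C u ≡ v ⊎ Cycle.succ C v ≡ u

module CycleProperties {V : Set} (C : Cycle V) where
  open Cycle C public

  _⊕_ : V → ℕ → V
  v ⊕ k = fold v succ k

  segment : V → List V
  segment a = a ∷ a ⊕ 1 ∷ a ⊕ 2 ∷ a ⊕ 3 ∷ []

  Adj-sym : ∀ {u v} → Adj C u v → Adj C v u
  Adj-sym (inj₁ e) = inj₂ e
  Adj-sym (inj₂ e) = inj₁ e

  ⊕-injective : ∀ k {u v} → u ⊕ k ≡ v ⊕ k → u ≡ v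
  ⊕-injective zero    e = e
  ⊕-injective (suc k) e = ⊕-injective k (succ-injective e)

  distinct : ∀ i (d : Fin 11) a → a ⊕ i ≢ a ⊕ (i + suc (toℕ d))
  distinct i d a e = noShortReturn d a (sym (⊕-injective i (trans e (fold-+ a succ i))))

  notAdjacent₂ : ∀ b → ¬ Adj C b (b ⊕ 2)
  notAdjacent₂ b (inj₁ e) = distinct 1 (# 0) b e
  notAdjacent₂ b (inj₂ e) = noShortReturn (# 2) b e

  notAdjacent₃ : ∀ b → ¬ Adj C b (b ⊕ 3)
  notAdjacent₃ b (inj₁ e) = distinct 1 (# 1) b e
  notAdjacent₃ b (inj₂ e) = noShortReturn (# 3) b e

  irreflexive : ∀ {u} → ¬ Adj C u u
  irreflexive (inj₁ e) = noShortReturn (# 0) _ e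
  irreflexive (inj₂ e) = noShortReturn (# 0) _ e

  noTriangle : ∀ {x y z} → Adj C x y → Adj C y z → Adj C z x → ⊥
  noTriangle (inj₁ refl) (inj₁ refl) (inj₁ e) = noShortReturn (# 2) _ e
  noTriangle (inj₂ refl) (inj₂ refl) (inj₂ e) = noShortReturn (# 2) _ e
  noTriangle (inj₁ a) (inj₂ b) c = irreflexive (subst (Adj C _) (succ-injective (trans a (sym b))) c)
  noTriangle (inj₂ a) (inj₁ b) c = irreflexive (subst (Adj C _) (trans (sym a) b) c)
  noTriangle (inj₁ a) (inj₁ b) (inj₂ c) = irreflexive (inj₁ (trans b (sym (trans (sym a) c))))
  noTriangle (inj₂ a) (inj₂ b) (inj₁ c) = irreflexive (inj₁ (trans a (trans (sym c) b)))

  orientation : ∀ {x0 x1 x2 x3} → Adj C x0 x1 → Adj C x1 x2 → Adj C x2 x3 → x0 ≢ x2 → x1 ≢ x3 →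
                (succ x0 ≡ x1 × succ x1 ≡ x2 × succ x2 ≡ x3) ⊎ (succ x1 ≡ x0 × succ x2 ≡ x1 × succ x3 ≡ x2)
  orientation (inj₁ a) (inj₁ b) (inj₁ c) _ _ = inj₁ (a , b , c)
  orientation (inj₂ a) (inj₂ b) (inj₂ c) _ _ = inj₂ (a , b , c)
  orientation (inj₁ a) (inj₂ b) _ n02 _ = ⊥-elim (n02 (succ-injective (trans a (sym b))))
  orientation (inj₂ a) (inj₁ b) _ n02 _ = ⊥-elim (n02 (trans (sym a) b))
  orientation (inj₁ _) (inj₁ b) (inj₂ c) _ n13 = ⊥-elim (n13 (succ-injective (trans b (sym c))))
  orientation (inj₂ _) (inj₂ b) (inj₁ c) _ n13 = ⊥-elim (n13 (trans (sym b) c))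

  noSquare : ∀ {x0 x1 x2 x3} → Adj C x0 x1 → Adj C x1 x2 → Adj C x2 x3 → Adj C x3 x0 →
             x0 ≢ x2 → x1 ≢ x3 → ⊥
  noSquare a b c d n02 n13 with orientation a b c n02 n13
  noSquare a b c (inj₁ d) _   _   | inj₁ (refl , refl , refl) = noShortReturn (# 3) _ d
  noSquare a b c (inj₂ d) _   n13 | inj₁ (refl , refl , refl) = n13 d
  noSquare a b c (inj₁ d) n02 _   | inj₂ (_ , _ , e3) = n02 (trans (sym d) e3)
  noSquare a b c (inj₂ d) _   _   | inj₂ (refl , refl , refl) = noShortReturn (# 3) _ d

  neighbours : ∀ {x y z u} → Adj C x y → Adj C x z → y ≢ z → Adj C x u → u ≡ y ⊎ u ≡ z
  neighbours (inj₁ a) _        _ (inj₁ e) = inj₁ (trans (sym e) a)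
  neighbours (inj₂ a) (inj₁ b) _ (inj₁ e) = inj₂ (trans (sym e) b)
  neighbours (inj₁ a) (inj₁ b) n _        = ⊥-elim (n (trans (sym a) b))
  neighbours (inj₂ a) (inj₂ b) n _        = ⊥-elim (n (succ-injective (trans a (sym b))))
  neighbours (inj₂ a) _        _ (inj₂ e) = inj₁ (succ-injective (trans e (sym a)))
  neighbours (inj₁ a) (inj₂ b) _ (inj₂ e) = inj₂ (succ-injective (trans e (sym b)))

  noThreeNeighbours : ∀ {x y z w} → Adj C x y → Adj C x z → Adj C x w → y ≢ z → y ≢ w → z ≢ w → ⊥
  noThreeNeighbours a b c nyz nyw nzw with neighbours a b nyz c
  ... | inj₁ e = nyw (sym e)
  ... | inj₂ e = nzw (sym e)

module TwoCycles {V : Set} (X Y : Cycle V) where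
  open CycleProperties X public
  open CycleProperties Y public using () renaming
    ( Adj-sym to Y-sym; noTriangle to noTriangleY; noSquare to noSquareY
    ; noThreeNeighbours to noThreeNeighboursY)

  _~_ : V → V → Set
  u ~ v = Adj X u v ⊎ Adj Y u v

  ~-sym : ∀ {u v} → u ~ v → v ~ u
  ~-sym (inj₁ e) = inj₁ (Adj-sym e)
  ~-sym (inj₂ e) = inj₂ (Y-sym e)

  -- The three pairs of the X-segment at a that are not X-edges, as Y-edges
  -- (they form the Y-path (a ⊕ 1) (a ⊕ 3) a (a ⊕ 2)).
  record Chords (a : V) : Set where
    constructor chords
    field
      chord₁₃ : Adj Y (a ⊕ 1) (a ⊕ 3)
      chord₃₀ : Adj Y (a ⊕ 3) a
      chord₀₂ : Adj Y a (a ⊕ 2)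

  IsSegment : List V → Set
  IsSegment xs = Σ V λ a → Chords a × xs ↭ segment a

  IsSegment-resp : ∀ {xs ys} → xs ↭ ys → IsSegment ys → IsSegment xs
  IsSegment-resp p (a , c , q) = a , c , ↭-trans p q

  pathsToSegment : ∀ {x0 x1 x2 x3} → x0 ≢ x2 → x1 ≢ x3 →
    Adj X x0 x1 → Adj X x1 x2 → Adj X x2 x3 → Adj Y x0 x2 → Adj Y x1 x3 → Adj Y x0 x3 →
    IsSegment (x0 ∷ x1 ∷ x2 ∷ x3 ∷ [])
  pathsToSegment n02 n13 a01 a12 a23 b02 b13 b03 with orientation a01 a12 a23 n02 n13
  ... | inj₁ (refl , refl , refl) = _ , chords b13 (Y-sym b03) b02 , ↭-refl
  ... | inj₂ (refl , refl , refl) = _ , chords (Y-sym b02) b03 (Y-sym b13) , ↭-reverse (segment _)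

  centredX : ∀ {x0 x1 x2 x3} → x0 ≢ x1 → x0 ≢ x2 → x0 ≢ x3 → x1 ≢ x2 →
    Adj X x0 x1 → Adj X x0 x2 → Adj Y x0 x3 → x1 ~ x2 → x1 ~ x3 → x2 ~ x3 →
    IsSegment (x0 ∷ x1 ∷ x2 ∷ x3 ∷ [])
  centredX _ _ _ _ a01 a02 _ (inj₁ a12) _ _ = ⊥-elim (noTriangle a01 a12 (Adj-sym a02))
  centredX n01 n02 n03 n12 a01 a02 b03 (inj₂ b12) e13 e23 with e13 | e23
  ... | inj₁ a13 | inj₁ a23 = ⊥-elim (noSquare a01 a13 (Adj-sym a23) (Adj-sym a02) n03 n12)
  ... | inj₂ b13 | inj₂ b23 = ⊥-elim (noThreeNeighboursY (Y-sym b03) (Y-sym b13) (Y-sym b23) n01 n02 n12)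
  ... | inj₁ a13 | inj₂ b23 = IsSegment-resp (shift _ (_ ∷ _ ∷ []) (_ ∷ []))
        (pathsToSegment (≢-sym n12) n03 (Adj-sym a02) a01 a13 (Y-sym b12) b03 b23)
  ... | inj₂ b13 | inj₁ a23 = IsSegment-resp (swap _ _ ↭-refl)
        (pathsToSegment n12 n03 (Adj-sym a01) a02 a23 b12 b03 b13)

  centredY : ∀ {x0 x1 x2 x3} → x0 ≢ x1 → x0 ≢ x2 → x0 ≢ x3 → x1 ≢ x2 → x1 ≢ x3 → x2 ≢ x3 →
    Adj Y x0 x1 → Adj Y x0 x2 → Adj X x0 x3 → x1 ~ x2 → x1 ~ x3 → x2 ~ x3 →
    IsSegment (x0 ∷ x1 ∷ x2 ∷ x3 ∷ [])
  centredY _ _ _ _ _ _ b01 b02 _ (inj₂ b12) _ _ = ⊥-elim (noTriangleY b01 b12 (Y-sym b02))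
  centredY n01 n02 n03 n12 n13 n23 b01 b02 a03 (inj₁ a12) e13 e23 with e13 | e23
  ... | inj₂ b13 | inj₂ b23 = ⊥-elim (noSquareY b01 b13 (Y-sym b23) (Y-sym b02) n03 n12)
  ... | inj₁ a13 | inj₁ a23 = ⊥-elim (noThreeNeighbours (Adj-sym a03) (Adj-sym a13) (Adj-sym a23) n01 n02 n12)
  ... | inj₁ a13 | inj₂ b23 = IsSegment-resp (prep _ (shift _ (_ ∷ _ ∷ []) []))
        (pathsToSegment n01 (≢-sym n23) a03 (Adj-sym a13) a12 b01 (Y-sym b23) b02)
  ... | inj₂ b13 | inj₁ a23 = IsSegment-resp (prep _ (↭-sym (↭-reverse (_ ∷ _ ∷ _ ∷ []))))
        (pathsToSegment n02 (≢-sym n13) a03 (Adj-sym a23) (Adj-sym a12) b02 (Y-sym b13) b01)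

  -- Four distinct vertices spanning a K4 in X ∪ Y form an X-segment with
  -- Y-chords: each cycle contributes a Hamiltonian path of the K4.
  k4IsSegment : ∀ {x0 x1 x2 x3} → x0 ≢ x1 → x0 ≢ x2 → x0 ≢ x3 → x1 ≢ x2 → x1 ≢ x3 → x2 ≢ x3 →
    x0 ~ x1 → x0 ~ x2 → x0 ~ x3 → x1 ~ x2 → x1 ~ x3 → x2 ~ x3 →
    IsSegment (x0 ∷ x1 ∷ x2 ∷ x3 ∷ [])
  k4IsSegment n01 n02 n03 n12 n13 n23 e01 e02 e03 e12 e13 e23 with e01 | e02 | e03
  ... | inj₁ a01 | inj₁ a02 | inj₁ a03 = ⊥-elim (noThreeNeighbours a01 a02 a03 n12 n13 n23)
  ... | inj₂ b01 | inj₂ b02 | inj₂ b03 = ⊥-elim (noThreeNeighboursY b01 b02 b03 n12 n13 n23)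
  ... | inj₁ a01 | inj₁ a02 | inj₂ b03 = centredX n01 n02 n03 n12 a01 a02 b03 e12 e13 e23
  ... | inj₁ a01 | inj₂ b02 | inj₁ a03 = IsSegment-resp (prep _ (prep _ (swap _ _ ↭-refl)))
        (centredX n01 n03 n02 n13 a01 a03 b02 e13 e12 (~-sym e23))
  ... | inj₂ b01 | inj₁ a02 | inj₁ a03 = IsSegment-resp (prep _ (↭-sym (shift _ (_ ∷ _ ∷ []) [])))
        (centredX n02 n03 n01 n23 a02 a03 b01 e23 (~-sym e12) (~-sym e13))
  ... | inj₂ b01 | inj₂ b02 | inj₁ a03 = centredY n01 n02 n03 n12 n13 n23 b01 b02 a03 e12 e13 e23
  ... | inj₂ b01 | inj₁ a02 | inj₂ b03 = IsSegment-resp (prep _ (prep _ (swap _ _ ↭-refl)))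
        (centredY n01 n03 n02 n13 n12 (≢-sym n23) b01 b03 a02 e13 e12 (~-sym e23))
  ... | inj₁ a01 | inj₂ b02 | inj₂ b03 = IsSegment-resp (prep _ (↭-sym (shift _ (_ ∷ _ ∷ []) [])))
        (centredY n02 n03 n01 n23 (≢-sym n12) (≢-sym n13) b02 b03 a01 e23 (~-sym e12) (~-sym e13))

pattern pos₀ = here refl
pattern pos₁ = there (here refl)
pattern pos₂ = there (there (here refl))
pattern pos₃ = there (there (there (here refl)))

record K4Partition {V : Set} (X Y : Cycle V) : Set₁ where
  field
    Block            : Set
    block            : V → Block
    vertex           : Block → Fin 4 → V
    block-vertex     : ∀ b i → block (vertex b i) ≡ b
    vertex-block     : ∀ u → Σ (Fin 4) λ i → vertex (block u) i ≡ u
    vertex-injective : ∀ b {i j} → vertex b i ≡ vertex b j → i ≡ j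
    spansK4          : ∀ b {i j} → i ≢ j → Adj X (vertex b i) (vertex b j) ⊎ Adj Y (vertex b i) (vertex b j)

swapCycles : ∀ {V} {X Y : Cycle V} → K4Partition X Y → K4Partition Y X
swapCycles P = record
  { Block = Block ; block = block ; vertex = vertex ; block-vertex = block-vertex
  ; vertex-block = vertex-block ; vertex-injective = vertex-injective
  ; spansK4 = λ b n → [ inj₂ , inj₁ ]′ (spansK4 b n) }
  where open K4Partition P

-- v is interior to the path that the cycle C traces on v's block (blocks
-- given by the map block): it has two distinct C-neighbours in its block.
record Interior {V B : Set} (block : V → B) (C : Cycle V) (v : V) : Set where
  constructor interior
  field
    {left right} : V
    left≢right   : left ≢ right
    adjLeft      : Adj C v left
    adjRight     : Adj C v right
    blockLeft    : block left ≡ block v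
    blockRight   : block right ≡ block v

interiorNeighbour : ∀ {V B} {block : V → B} {C v u} → Interior block C v → Adj C v u → block u ≡ block v
interiorNeighbour {C = C} (interior l≢r al ar bl br) au with CycleProperties.neighbours C al ar l≢r au
... | inj₁ refl = bl
... | inj₂ refl = br

module Segments {V : Set} {X Y : Cycle V} (P : K4Partition X Y) where
  open K4Partition P public
  open TwoCycles X Y public

  members : Block → List V
  members b = vertex b zero ∷ vertex b (# 1) ∷ vertex b (# 2) ∷ vertex b (# 3) ∷ []

  listed : ∀ u → u ∈ members (block u)
  listed u with vertex-block u
  ... | zero , e = here (sym e)
  ... | suc zero , e = there (here (sym e))
  ... | suc (suc zero) , e = there (there (here (sym e)))
  ... | suc (suc (suc zero)) , e = there (there (there (here (sym e))))

  listed-block : ∀ {b u} → u ∈ members b → block u ≡ b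
  listed-block {b} pos₀ = block-vertex b _
  listed-block {b} pos₁ = block-vertex b _
  listed-block {b} pos₂ = block-vertex b _
  listed-block {b} pos₃ = block-vertex b _

  record SegmentAt (a : V) : Set where
    field
      member   : ∀ {u} → block u ≡ block a → u ∈ segment a
      inBlock  : ∀ {u} → u ∈ segment a → block u ≡ block a
      chordsAt : Chords a
  open SegmentAt public

  blockIsSegment : ∀ b → IsSegment (members b)
  blockIsSegment b = k4IsSegment (different λ ()) (different λ ()) (different λ ())
                                 (different λ ()) (different λ ()) (different λ ())
                                 (spansK4 b λ ()) (spansK4 b λ ()) (spansK4 b λ ())
                                 (spansK4 b λ ()) (spansK4 b λ ()) (spansK4 b λ ())
    where
      different : ∀ {i j} → i ≢ j → vertex b i ≢ vertex b j
      different n e = n (vertex-injective b e)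

  blockSegment : ∀ v → Σ V λ a → SegmentAt a × block v ≡ block a
  blockSegment v with blockIsSegment (block v)
  ... | a , ch , perm = a , record { member = member′ ; inBlock = inBlock′ ; chordsAt = ch } , sym block-a
    where
      fromSegment : ∀ {u} → u ∈ segment a → block u ≡ block v
      fromSegment m = listed-block (∈-resp-↭ (↭-sym perm) m)
      block-a : block a ≡ block v
      block-a = fromSegment pos₀
      member′ : ∀ {u} → block u ≡ block a → u ∈ segment a
      member′ {u} e = ∈-resp-↭ perm (subst (λ c → u ∈ members c) (trans e block-a) (listed u))
      inBlock′ : ∀ {u} → u ∈ segment a → block u ≡ block a
      inBlock′ m = trans (fromSegment m) (sym block-a)

  leavesSegment : ∀ a → a ⊕ 4 ∉ segment a
  leavesSegment a (here e)                         = noShortReturn (# 3) a e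
  leavesSegment a (there (here e))                 = distinct 1 (# 2) a (sym e)
  leavesSegment a (there (there (here e)))         = distinct 2 (# 1) a (sym e)
  leavesSegment a (there (there (there (here e)))) = distinct 3 (# 0) a (sym e)

  nextSegment : ∀ {a} → SegmentAt a → SegmentAt (a ⊕ 4)
  nextSegment {a} S with blockSegment (a ⊕ 4)
  ... | a′ , S′ , e = startsAt (member S′ e)
    where
      -- a′ cannot be one of a ⊕ 1, a ⊕ 2, a ⊕ 3, for then a ⊕ 4 would be in the block of a.
      clash : ∀ {k} → a′ ≡ a ⊕ k → a ⊕ k ∈ segment a → ⊥
      clash r m = leavesSegment a (member S (trans e (trans (cong block r) (inBlock S m))))
      startsAt : a ⊕ 4 ∈ segment a′ → SegmentAt (a ⊕ 4)
      startsAt (here q)                         = subst SegmentAt (sym q) S′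
      startsAt (there (here q))                 = ⊥-elim (clash {3} (⊕-injective 1 (sym q)) pos₃)
      startsAt (there (there (here q)))         = ⊥-elim (clash {2} (⊕-injective 2 (sym q)) pos₂)
      startsAt (there (there (there (here q)))) = ⊥-elim (clash {1} (⊕-injective 3 (sym q)) pos₁)

  sameBlock-~ : ∀ {u v} → block u ≡ block v → u ≢ v → u ~ v
  sameBlock-~ {u} {v} e u≢v with vertex-block u | vertex-block v
  ... | i , eu | j , ev = subst₂ _~_ eu ev′ (spansK4 (block u) i≢j)
    where
      ev′ : vertex (block u) j ≡ v
      ev′ = trans (cong (λ c → vertex c j) e) ev
      i≢j : i ≢ j
      i≢j i≡j = u≢v (trans (sym eu) (trans (cong (vertex (block u)) i≡j) ev′))

  -- No pair of a segment is an edge of both cycles: X joins only consecutive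
  -- positions, and a Y-edge between consecutive positions would close a
  -- Y-triangle or a Y-square with the chords.
  segmentEdgesDisjoint : ∀ {a u v} → Chords a → u ∈ segment a → v ∈ segment a → Adj X u v → Adj Y u v → ⊥
  segmentEdgesDisjoint _ pos₀ pos₀ x _ = irreflexive x
  segmentEdgesDisjoint _ pos₁ pos₁ x _ = irreflexive x
  segmentEdgesDisjoint _ pos₂ pos₂ x _ = irreflexive x
  segmentEdgesDisjoint _ pos₃ pos₃ x _ = irreflexive x
  segmentEdgesDisjoint _ pos₀ pos₂ x _ = notAdjacent₂ _ x
  segmentEdgesDisjoint _ pos₂ pos₀ x _ = notAdjacent₂ _ (Adj-sym x)
  segmentEdgesDisjoint _ pos₁ pos₃ x _ = notAdjacent₂ _ x
  segmentEdgesDisjoint _ pos₃ pos₁ x _ = notAdjacent₂ _ (Adj-sym x)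
  segmentEdgesDisjoint _ pos₀ pos₃ x _ = notAdjacent₃ _ x
  segmentEdgesDisjoint _ pos₃ pos₀ x _ = notAdjacent₃ _ (Adj-sym x)
  segmentEdgesDisjoint (chords c₁₃ c₃₀ c₀₂) pos₀ pos₁ _ y = noTriangleY y c₁₃ c₃₀
  segmentEdgesDisjoint (chords c₁₃ c₃₀ c₀₂) pos₁ pos₀ _ y = noTriangleY (Y-sym y) c₁₃ c₃₀
  segmentEdgesDisjoint (chords c₁₃ c₃₀ c₀₂) pos₂ pos₃ _ y = noTriangleY y c₃₀ c₀₂
  segmentEdgesDisjoint (chords c₁₃ c₃₀ c₀₂) pos₃ pos₂ _ y = noTriangleY (Y-sym y) c₃₀ c₀₂
  segmentEdgesDisjoint {a} (chords c₁₃ c₃₀ c₀₂) pos₁ pos₂ _ y =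
    noSquareY y (Y-sym c₀₂) (Y-sym c₃₀) (Y-sym c₁₃) (≢-sym (distinct 0 (# 0) a)) (distinct 2 (# 0) a)
  segmentEdgesDisjoint {a} (chords c₁₃ c₃₀ c₀₂) pos₂ pos₁ _ y =
    noSquareY (Y-sym y) (Y-sym c₀₂) (Y-sym c₃₀) (Y-sym c₁₃) (≢-sym (distinct 0 (# 0) a)) (distinct 2 (# 0) a)

  noDoubleEdge : ∀ {u v} → block u ≡ block v → Adj X u v → Adj Y u v → ⊥
  noDoubleEdge {u} {v} e x y with blockSegment v
  ... | a , S , ev = segmentEdgesDisjoint (chordsAt S) (member S (trans e ev)) (member S ev) x y

  module _ {a} (S : SegmentAt a) where
    private
      together : ∀ {u v} → u ∈ segment a → v ∈ segment a → block u ≡ block v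
      together m n = trans (inBlock S m) (sym (inBlock S n))
    open Chords (chordsAt S)

    interior₀ : Interior block Y a
    interior₀ = interior (distinct 2 (# 0) a) chord₀₂ (Y-sym chord₃₀) (together pos₂ pos₀) (together pos₃ pos₀)

    interior₁ : Interior block X (a ⊕ 1)
    interior₁ = interior (distinct 0 (# 1) a) (inj₂ refl) (inj₁ refl) (together pos₀ pos₁) (together pos₂ pos₁)

    interior₂ : Interior block X (a ⊕ 2)
    interior₂ = interior (distinct 1 (# 1) a) (inj₂ refl) (inj₁ refl) (together pos₁ pos₂) (together pos₃ pos₂)

    interior₃ : Interior block Y (a ⊕ 3)
    interior₃ = interior (≢-sym (distinct 0 (# 0) a)) (Y-sym chord₁₃) chord₃₀ (together pos₁ pos₃) (together pos₀ pos₃)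

  interiorSomewhere : ∀ v → Interior block X v ⊎ Interior block Y v
  interiorSomewhere v with blockSegment v
  ... | a , S , e with member S e
  ... | pos₀ = inj₂ (interior₀ S)
  ... | pos₁ = inj₁ (interior₁ S)
  ... | pos₂ = inj₁ (interior₂ S)
  ... | pos₃ = inj₂ (interior₃ S)

otherCycle : ∀ {V} {X W : Cycle V} {u v} → ¬ Adj X u v → Adj X u v ⊎ Adj W u v → Adj W u v
otherCycle notX (inj₁ x) = ⊥-elim (notX x)
otherCycle _    (inj₂ w) = w

-- Its two
-- X-neighbours x, y would lie in its block in both partitions, so x y would
-- be an edge of Y and of Z, and in the Y ∪ Z-partition x and y would share
-- a block, contradicting that the two cycles are edge-disjoint inside a block.
notInteriorTwice : ∀ {V} {X Y Z : Cycle V} (Pxy : K4Partition X Y) (Pxz : K4Partition X Z) (Pyz : K4Partition Y Z) →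
  ∀ v → Interior (K4Partition.block Pxy) X v → Interior (K4Partition.block Pxz) X v → ⊥
notInteriorTwice {X = X} {Y} {Z} Pxy Pxz Pyz v (interior {x} {y} x≢y adjX adjY bx by) Ixz = inBothYZ (YZ.interiorSomewhere x)
  where
    module XY = Segments Pxy
    module XZ = Segments Pxz
    module YZ = Segments Pyz
    notX : ¬ Adj X x y
    notX a = CycleProperties.noTriangle X adjX a (CycleProperties.Adj-sym X adjY)
    xyInY : Adj Y x y
    xyInY = otherCycle {X = X} {W = Y} notX (XY.sameBlock-~ (trans bx (sym by)) x≢y)
    xyInZ : Adj Z x y
    xyInZ = otherCycle {X = X} {W = Z} notX (XZ.sameBlock-~ sameXZBlock x≢y)
      where
        sameXZBlock : XZ.block x ≡ XZ.block y
        sameXZBlock = trans (interiorNeighbour Ixz adjX) (sym (interiorNeighbour Ixz adjY))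
    inBothYZ : Interior YZ.block Y x ⊎ Interior YZ.block Z x → ⊥
    inBothYZ (inj₁ Iy) = YZ.noDoubleEdge (sym (interiorNeighbour Iy xyInY)) xyInY xyInZ
    inBothYZ (inj₂ Iz) = YZ.noDoubleEdge (sym (interiorNeighbour Iz xyInZ)) xyInY xyInZ

disjointPairs : ∀ {V : Set} {u a b c d : V} → u ≡ a ⊎ u ≡ b → u ≡ c ⊎ u ≡ d →
                a ≢ c → a ≢ d → b ≢ c → b ≢ d → ⊥
disjointPairs (inj₁ refl) (inj₁ refl) a≢c _ _ _ = a≢c refl
disjointPairs (inj₁ refl) (inj₂ refl) _ a≢d _ _ = a≢d refl
disjointPairs (inj₂ refl) (inj₁ refl) _ _ b≢c _ = b≢c refl
disjointPairs (inj₂ refl) (inj₂ refl) _ _ _ b≢d = b≢d refl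

module ThreePartitions {V : Set} {C₁ C₂ C₃ : Cycle V}
    (P₁₂ : K4Partition C₁ C₂) (P₁₃ : K4Partition C₁ C₃) (P₂₃ : K4Partition C₂ C₃) where
  module B₁₂ = Segments P₁₂
  module B₁₃ = Segments P₁₃
  module B₃₂ = Segments (swapCycles P₂₃)
  open CycleProperties C₁ using (_⊕_; ⊕-injective; distinct)
  open CycleProperties C₂ using () renaming (neighbours to neighbours₂; Adj-sym to sym₂)
  open CycleProperties C₃ using () renaming
    (_⊕_ to _⊕₃_; succ to succ₃; succ-injective to succ₃-injective; neighbours to neighbours₃; Adj-sym to sym₃)

  -- Fix a P₁₂-block, a C₁-segment starting at a₀, and number the vertices
  -- along C₁ from a₀.  The P₁₃-block of vertex 8 starts at one of the
  -- vertices 5, 6, 7, 8.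
  module FromBlock (a₀ : V) (S₀ : B₁₂.SegmentAt a₀) where
    p : ℕ → V
    p k = a₀ ⊕ k

    apart : ∀ i (d : Fin 11) → p i ≢ p (i + suc (toℕ d))
    apart i d = distinct i d a₀

    S₈ : B₁₂.SegmentAt (p 8)
    S₈ = B₁₂.nextSegment (B₁₂.nextSegment S₀)

    S₁₂ : B₁₂.SegmentAt (p 12)
    S₁₂ = B₁₂.nextSegment S₈

    -- Offsets 0, 1 and 3 between the two partitions put some vertex in the
    -- interior of its C₁-path in both P₁₂ and P₁₃.
    offset0 : B₁₃.SegmentAt (p 8) → ⊥
    offset0 T₈ = notInteriorTwice P₁₂ P₁₃ P₂₃ (p 9) (B₁₂.interior₁ S₈) (B₁₃.interior₁ T₈)

    offset1 : B₁₃.SegmentAt (p 7) → ⊥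
    offset1 T₇ = notInteriorTwice P₁₂ P₁₃ P₂₃ (p 9) (B₁₂.interior₁ S₈) (B₁₃.interior₂ T₇)

    offset3 : B₁₃.SegmentAt (p 5) → ⊥
    offset3 T₅ = notInteriorTwice P₁₂ P₁₃ P₂₃ (p 10) (B₁₂.interior₂ S₈) (B₁₃.interior₁ (B₁₃.nextSegment T₅))

    -- Offset 2: the P₁₃-blocks are the C₁-segments at 6, 10, 14.  Vertex 12
    -- lies in a C₃-segment of P₂₃; it is not interior to its C₂-path there
    -- (it already is in P₁₂), so it is second or third on that C₃-segment,
    -- and the known C₂- and C₃-neighbourhoods of the vertices 10, 12, 14, 15
    -- rule out both positions.
    module Offset2 (T₆ : B₁₃.SegmentAt (p 6)) where
      T₁₀ : B₁₃.SegmentAt (p 10)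
      T₁₀ = B₁₃.nextSegment T₆

      T₁₄ : B₁₃.SegmentAt (p 14)
      T₁₄ = B₁₃.nextSegment T₁₀

      open B₁₃.Chords (B₁₃.chordsAt T₁₀) using () renaming (chord₀₂ to c₃-10-12; chord₃₀ to c₃-13-10)
      open B₁₃.Chords (B₁₃.chordsAt T₁₄) using () renaming (chord₀₂ to c₃-14-16; chord₃₀ to c₃-17-14)
      open B₁₂.Chords (B₁₂.chordsAt S₁₂) using () renaming
        (chord₁₃ to c₂-13-15; chord₃₀ to c₂-15-12; chord₀₂ to c₂-12-14)
      open B₁₂.Chords (B₁₂.chordsAt S₈) using () renaming (chord₀₂ to c₂-8-10)

      N₃p10 : ∀ {u} → Adj C₃ (p 10) u → u ≡ p 12 ⊎ u ≡ p 13
      N₃p10 = neighbours₃ c₃-10-12 (sym₃ c₃-13-10) (apart 12 (# 0))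

      N₃p14 : ∀ {u} → Adj C₃ (p 14) u → u ≡ p 16 ⊎ u ≡ p 17
      N₃p14 = neighbours₃ c₃-14-16 (sym₃ c₃-17-14) (apart 16 (# 0))

      N₂p12 : ∀ {u} → Adj C₂ (p 12) u → u ≡ p 14 ⊎ u ≡ p 15
      N₂p12 = neighbours₂ c₂-12-14 (sym₂ c₂-15-12) (apart 14 (# 0))

      N₂p15 : ∀ {u} → Adj C₂ (p 15) u → u ≡ p 13 ⊎ u ≡ p 12
      N₂p15 = neighbours₂ (sym₂ c₂-13-15) c₂-15-12 (≢-sym (apart 12 (# 0)))

      N₂p10 : Adj C₂ (p 10) (p 14) → ∀ {u} → Adj C₂ (p 10) u → u ≡ p 8 ⊎ u ≡ p 14
      N₂p10 h = neighbours₂ (sym₂ c₂-8-10) h (apart 8 (# 5))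

      notC₂-10-15 : Adj C₂ (p 15) (p 10) → ⊥
      notC₂-10-15 h = [ apart 10 (# 2) , apart 10 (# 1) ]′ (N₂p15 h)

      -- p 12 second on its C₃-segment: p 10 is the first or the third vertex.
      position1 : ∀ {a} → B₃₂.SegmentAt a → p 12 ≡ a ⊕₃ 1 → ⊥
      position1 {a} U q = byNeighbour (sym₃ c₃-10-12)
        where
          open B₃₂.Chords (B₃₂.chordsAt U)
          d∈N₂p12 : a ⊕₃ 3 ≡ p 14 ⊎ a ⊕₃ 3 ≡ p 15
          d∈N₂p12 = N₂p12 (subst (λ t → Adj C₂ t (a ⊕₃ 3)) (sym q) chord₁₃)
          firstIs10 : p 10 ≡ a → ⊥
          firstIs10 refl with d∈N₂p12
          ... | inj₂ r = notC₂-10-15 (subst (λ t → Adj C₂ t (p 10)) r chord₃₀)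
          ... | inj₁ r = disjointPairs c∈N₂p10 c∈N₃p14 (apart 8 (# 7)) (apart 8 (# 8)) (apart 14 (# 1)) (apart 14 (# 2))
            where
              c∈N₂p10 : p 10 ⊕₃ 2 ≡ p 8 ⊎ p 10 ⊕₃ 2 ≡ p 14
              c∈N₂p10 = N₂p10 (sym₂ (subst (λ t → Adj C₂ t (p 10)) r chord₃₀)) chord₀₂
              c∈N₃p14 : p 10 ⊕₃ 2 ≡ p 16 ⊎ p 10 ⊕₃ 2 ≡ p 17
              c∈N₃p14 = N₃p14 (subst (λ t → Adj C₃ t (p 10 ⊕₃ 2)) r (inj₂ refl))
          byNeighbour : Adj C₃ (p 12) (p 10) → ⊥
          byNeighbour (inj₁ e) = disjointPairs (N₃p10 (inj₁ (cong succ₃ (trans (sym e) (cong succ₃ q))))) d∈N₂p12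
                                   (apart 12 (# 1)) (apart 12 (# 2)) (apart 13 (# 0)) (apart 13 (# 1))
          byNeighbour (inj₂ e) = firstIs10 (succ₃-injective (trans e q))

      -- p 12 third on its C₃-segment: p 10 is the second or the fourth vertex.
      position2 : ∀ {a} → B₃₂.SegmentAt a → p 12 ≡ a ⊕₃ 2 → ⊥
      position2 {a} U q = byNeighbour (sym₃ c₃-10-12)
        where
          open B₃₂.Chords (B₃₂.chordsAt U)
          a∈N₂p12 : a ≡ p 14 ⊎ a ≡ p 15
          a∈N₂p12 = N₂p12 (sym₂ (subst (Adj C₂ a) (sym q) chord₀₂))
          fourthIs10 : p 10 ≡ a ⊕₃ 3 → ⊥
          fourthIs10 p10≡d with a∈N₂p12
          ... | inj₂ refl = notC₂-10-15 (subst (Adj C₂ (p 15)) (sym p10≡d) (sym₂ chord₃₀))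
          ... | inj₁ refl = disjointPairs b∈N₂p10 b∈N₃p14 (apart 8 (# 7)) (apart 8 (# 8)) (apart 14 (# 1)) (apart 14 (# 2))
            where
              b∈N₂p10 : p 14 ⊕₃ 1 ≡ p 8 ⊎ p 14 ⊕₃ 1 ≡ p 14
              b∈N₂p10 = N₂p10 (subst (λ t → Adj C₂ t (p 14)) (sym p10≡d) chord₃₀)
                              (sym₂ (subst (Adj C₂ (p 14 ⊕₃ 1)) (sym p10≡d) chord₁₃))
              b∈N₃p14 : p 14 ⊕₃ 1 ≡ p 16 ⊎ p 14 ⊕₃ 1 ≡ p 17
              b∈N₃p14 = N₃p14 (inj₁ refl)
          byNeighbour : Adj C₃ (p 12) (p 10) → ⊥
          byNeighbour (inj₁ e) = fourthIs10 (trans (sym e) (cong succ₃ q))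
          byNeighbour (inj₂ e) = disjointPairs (N₃p10 (inj₂ (sym (succ₃-injective (trans e q))))) a∈N₂p12
                                   (apart 12 (# 1)) (apart 12 (# 2)) (apart 13 (# 0)) (apart 13 (# 1))

      -- At either end of its C₃-segment, p 12 would be interior to its C₂-path
      -- in both P₁₂ and P₂₃.
      contradiction : ⊥
      contradiction with B₃₂.blockSegment (p 12)
      ... | a , U , e with B₃₂.member U e
      ... | here q = notInteriorTwice (swapCycles P₁₂) P₂₃ P₁₃ (p 12) (B₁₂.interior₀ S₁₂)
                       (subst (Interior B₃₂.block C₂) (sym q) (B₃₂.interior₀ U))
      ... | there (here q) = position1 U q
      ... | there (there (here q)) = position2 U q
      ... | there (there (there (here q))) = notInteriorTwice (swapCycles P₁₂) P₂₃ P₁₃ (p 12) (B₁₂.interior₀ S₁₂)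
                       (subst (Interior B₃₂.block C₂) (sym q) (B₃₂.interior₃ U))

    contradiction : ⊥
    contradiction with B₁₃.blockSegment (p 8)
    ... | a , T , e with B₁₃.member T e
    ... | here q                         = offset0 (subst B₁₃.SegmentAt (sym q) T)
    ... | there (here q)                 = offset1 (subst B₁₃.SegmentAt (sym (⊕-injective 1 q)) T)
    ... | there (there (here q))         = Offset2.contradiction (subst B₁₃.SegmentAt (sym (⊕-injective 2 q)) T)
    ... | there (there (there (here q))) = offset3 (subst B₁₃.SegmentAt (sym (⊕-injective 3 q)) T)

  impossible : V → ⊥
  impossible v with B₁₂.blockSegment v
  ... | a₀ , S₀ , _ = FromBlock.contradiction a₀ S₀

module _ {m : ℕ} (12≤n : 12 ≤ suc m) where
  private
    V : Set
    V = Fin (suc m)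

  -- A Hamiltonian cycle, given by its cyclic ordering of the vertices, as a
  -- cyclic order of length n ≥ 12: the successor of v is the vertex in the
  -- position after that of v.
  hamiltonianCycle : HamCycle m → Cycle V
  hamiltonianCycle C = record
    { succ           = succC
    ; succ-injective = λ e → from-injective (next-injective (to-injective e))
    ; noShortReturn  = λ d v loop → noShortOrbit (suc (toℕ d)) (from v) (s≤s z≤n) (<-≤-trans (s≤s (toℕ<n d)) 12≤n)
                         (trans (sym (strictlyInverseʳ _)) (cong from (trans (sym (fold-succC (suc (toℕ d)) v)) loop)))
    }
    where
      open Inverse C
      open CyclicSuccessor m
      succC : V → V
      succC v = to (next (from v))
      to-injective : ∀ {i j} → to i ≡ to j → i ≡ j
      to-injective {i} {j} e = trans (sym (strictlyInverseʳ i)) (trans (cong from e) (strictlyInverseʳ j))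
      from-injective : ∀ {u v} → from u ≡ from v → u ≡ v
      from-injective {u} {v} e = trans (sym (strictlyInverseˡ u)) (trans (cong to e) (strictlyInverseˡ v))
      fold-succC : ∀ k v → fold v succC k ≡ to (fold (from v) next k)
      fold-succC zero    v = sym (strictlyInverseˡ v)
      fold-succC (suc k) v = cong (λ t → to (next t)) (trans (cong from (fold-succC k v)) (strictlyInverseʳ _))

  cycleEdge : ∀ (C : HamCycle m) {u v} → cycleGraph C u v → Adj (hamiltonianCycle C) u v
  cycleEdge C (i , inj₁ (refl , refl)) = inj₁ (cong (λ j → to (next j)) (strictlyInverseʳ i))
    where open Inverse C
  cycleEdge C (i , inj₂ (refl , refl)) = inj₂ (cong (λ j → to (next j)) (strictlyInverseʳ i))
    where open Inverse C

  k4Partition : ∀ {k} (eq : 4 * k ≡ suc m) (C D : HamCycle m) →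
    K4Covered k eq (cycleGraph C ∪ᴳ cycleGraph D) → K4Partition (hamiltonianCycle C) (hamiltonianCycle D)
  k4Partition {k} eq C D (π , k4) = record
    { Block            = Fin k
    ; block            = λ u → proj₁ (from u)
    ; vertex           = λ b i → to (b , i)
    ; block-vertex     = λ b i → cong proj₁ (strictlyInverseʳ (b , i))
    ; vertex-block     = λ u → proj₂ (from u) , strictlyInverseˡ u
    ; vertex-injective = λ b e → cong proj₂ (to-injective e)
    ; spansK4          = λ b n → edge (k4 b _ _ n)
    }
    where
      open Inverse π
      to-injective : ∀ {x y} → to x ≡ to y → x ≡ y
      to-injective {x} {y} e = trans (sym (strictlyInverseʳ x)) (trans (cong from e) (strictlyInverseʳ y))
      edge : ∀ {u v} → (cycleGraph C ∪ᴳ cycleGraph D) u v → Adj (hamiltonianCycle C) u v ⊎ Adj (hamiltonianCycle D) u v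
      edge (inj₁ c) = inj₁ (cycleEdge C c)
      edge (inj₂ d) = inj₂ (cycleEdge D d)

lemma4 : (k m : ℕ) → (eq : 4 * k ≡ suc m) → 12 ≤ suc m →
    (C₁ C₂ C₃ : HamCycle m) →
    ¬ (K4Covered k eq (cycleGraph C₁ ∪ᴳ cycleGraph C₂)
    × K4Covered k eq (cycleGraph C₁ ∪ᴳ cycleGraph C₃)
    × K4Covered k eq (cycleGraph C₂ ∪ᴳ cycleGraph C₃))
lemma4 k m eq 12≤n C₁ C₂ C₃ (K₁₂ , K₁₃ , K₂₃) = ThreePartitions.impossible P₁₂ P₁₃ P₂₃ zero
  where
    P₁₂ : K4Partition (hamiltonianCycle 12≤n C₁) (hamiltonianCycle 12≤n C₂)
    P₁₂ = k4Partition 12≤n eq C₁ C₂ K₁₂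
    P₁₃ : K4Partition (hamiltonianCycle 12≤n C₁) (hamiltonianCycle 12≤n C₃)
    P₁₃ = k4Partition 12≤n eq C₁ C₃ K₁₃
    P₂₃ : K4Partition (hamiltonianCycle 12≤n C₂) (hamiltonianCycle 12≤n C₃)
    P₂₃ = k4Partition 12≤n eq C₂ C₃ K₂₃
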